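{- Let $K$ be a primary pseudoperfect number and let $C$ be a squarefree positive integer coprime to $K$. Then $KC$ is a primary pseudoperfect number if and only if $C-K\,\partial(C)=1$.
   Context: A squarefree positive integer $n$ is a primary pseudoperfect number if $\frac1n+\sum_{p\mid n}\frac1p=1$ (sum over prime divisors of $n$); equivalently $\partial(n)=n-1$. Here $\partial$ is the arithmetic derivative on positive integers, defined by $\partial(p)=1$ for every prime $p$ and $\partial(ab)=a\partial(b)+b\partial(a)$; for squarefree $n$, $\partial(n)=\sum_{p\mid n}n/p$. -}

module Defs where

open import Data.Nat using (ℕ; zero; suc; _+_; _*_; _/_; _≤_)
open import Data.Nat.Divisibility using (_∣_; _∣?_)
open import Data.Product using (_×_)
open import Relation.Binary.PropositionalEquality using (_≡_)
open import Data.Nat.Primality using (Prime; prime?)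
open import Data.List using (List; []; _∷_; map; filter; upTo)
open import Data.Nat.ListAction using (sum)
open import Relation.Nullary using (¬_)
open import Relation.Nullary.Decidable using (_×-dec_)

SquareFree : ℕ → Set
SquareFree n = ∀ p → Prime p → ¬ (p * p ∣ n)

-- the list of prime divisors of n (for n ≥ 1 every prime divisor is ≤ n)
primeDivisors : ℕ → List ℕ
primeDivisors n = filter (λ p → prime? p ×-dec (p ∣? n)) (upTo (suc n))

-- arithmetic derivative of a squarefree n: ∂(n) = Σ_{p ∣ n} n / p
∂ : ℕ → ℕ
∂ n = sum (map (λ p → quot n p) (primeDivisors n))
  where
  quot : ℕ → ℕ → ℕ
  quot n zero = zero
  quot n (suc p) = n / suc p

PrimaryPseudoperfect : ℕ → Set
PrimaryPseudoperfect n = SquareFree n × (1 ≤ n) × (∂ n + 1 ≡ n)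

{-# OPTIONS --safe #-}
-- Summing over one common range of candidate primes, ∂ n is the sum of n / p over the prime
-- divisors p of n. For coprime m and n every prime divides at most one of them, so the summands
-- are additive and ∂ (m * n) = ∂ m * n + m * ∂ n. With ∂ K + 1 = K, the equation
-- ∂ (K * C) + 1 = K * C becomes (K - 1) * C + K * ∂ C + 1 = K * C, that is C = K * ∂ C + 1;
-- and K * C is squarefree because K and C are squarefree and coprime.
module Submission where

open import Defs
open import Data.Nat using (ℕ; _+_; _*_; _≤_)
open import Data.Nat.Coprimality using (Coprime)
open import Relation.Binary.PropositionalEquality using (_≡_)
open import Function.Bundles using (_⇔_)

open import Data.Empty using (⊥-elim)
open import Data.List using (List; []; _∷_; map; filter; upTo; _++_; [_])
open import Data.List.Properties using (upTo-∷ʳ; map-++; map-cong)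
open import Data.Nat using (zero; suc; s≤s; _/_; _<_; _≤′_; ≤′-reflexive; ≤′-step)
open import Data.Nat.Coprimality using (coprime-divisor) renaming (sym to coprime-sym)
open import Data.Nat.Divisibility using (_∣_; _∣?_; ∣-trans; m∣m*n; ∣m⇒∣m*n; ∣n⇒∣m*n; ∣⇒≤)
open import Data.Nat.DivMod using (*-/-assoc)
open import Data.Nat.ListAction using (sum)
open import Data.Nat.ListAction.Properties using (sum-++)
open import Data.Nat.Primality using (Prime; prime?; euclidsLemma; ¬prime[1])
open import Data.Nat.Properties
open import Data.Nat.Solver using (module +-*-Solver)
open import Data.Product using (_×_; _,_)
open import Data.Sum using (inj₁; inj₂)
open import Function using (_∘′_)
open import Function.Bundles using (mk⇔; Equivalence)
open import Relation.Nullary using (yes; no; ¬_; contradiction)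
open import Relation.Nullary.Decidable using (_×-dec_)
open import Relation.Unary using (Decidable)
open import Relation.Binary.PropositionalEquality using (refl; sym; trans; cong; cong₂; subst; module ≡-Reasoning)

open +-*-Solver
open ≡-Reasoning

sum-map-filter : ∀ {a p} {A : Set a} {P : A → Set p} (P? : Decidable P) {f g : A → ℕ} →
  (∀ {x} → P x → g x ≡ f x) → (∀ {x} → ¬ P x → g x ≡ 0) →
  ∀ xs → sum (map f (filter P? xs)) ≡ sum (map g xs)
sum-map-filter P? g≡f g≡0 [] = refl
sum-map-filter P? g≡f g≡0 (x ∷ xs) with P? x
... | yes Px = cong₂ _+_ (sym (g≡f Px)) (sum-map-filter P? g≡f g≡0 xs)
... | no ¬Px = cong₂ _+_ (sym (g≡0 ¬Px)) (sum-map-filter P? g≡f g≡0 xs)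

sum-map-linear : ∀ {a} {A : Set a} {f g h : A → ℕ} (k l : ℕ) →
  (∀ x → h x ≡ f x * k + l * g x) →
  ∀ xs → sum (map h xs) ≡ sum (map f xs) * k + l * sum (map g xs)
sum-map-linear k l h≡ [] = solve 2 (λ k l → con 0 := con 0 :* k :+ l :* con 0) refl k l
sum-map-linear {f = f} {g} {h} k l h≡ (x ∷ xs) = begin
  h x + sum (map h xs)
    ≡⟨ cong₂ _+_ (h≡ x) (sum-map-linear k l h≡ xs) ⟩
  (f x * k + l * g x) + (sum (map f xs) * k + l * sum (map g xs))
    ≡⟨ solve 6 (λ k l a b c d → (a :* k :+ l :* b) :+ (c :* k :+ l :* d) := (a :+ c) :* k :+ l :* (b :+ d))
             refl k l (f x) (g x) (sum (map f xs)) (sum (map g xs)) ⟩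
  (f x + sum (map f xs)) * k + l * (g x + sum (map g xs)) ∎

sum-map-upTo-suc : ∀ (f : ℕ → ℕ) n → sum (map f (upTo (suc n))) ≡ sum (map f (upTo n)) + f n
sum-map-upTo-suc f n = begin
  sum (map f (upTo (suc n)))      ≡⟨ cong (sum ∘′ map f) (sym (upTo-∷ʳ n)) ⟩
  sum (map f (upTo n ++ [ n ]))   ≡⟨ cong sum (map-++ f (upTo n) [ n ]) ⟩
  sum (map f (upTo n) ++ [ f n ]) ≡⟨ sum-++ (map f (upTo n)) [ f n ] ⟩
  sum (map f (upTo n)) + (f n + 0) ≡⟨ cong (sum (map f (upTo n)) +_) (+-identityʳ (f n)) ⟩
  sum (map f (upTo n)) + f n ∎

sum-map-upTo-vanishing : ∀ {f : ℕ → ℕ} {m n} → (∀ x → m ≤ x → f x ≡ 0) → m ≤ n →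
  sum (map f (upTo n)) ≡ sum (map f (upTo m))
sum-map-upTo-vanishing {f} {m} f≡0 m≤n = go (≤⇒≤′ m≤n)
  where
  go : ∀ {n} → m ≤′ n → sum (map f (upTo n)) ≡ sum (map f (upTo m))
  go (≤′-reflexive refl) = refl
  go {suc n} (≤′-step m≤′n) = begin
    sum (map f (upTo (suc n)))  ≡⟨ sum-map-upTo-suc f n ⟩
    sum (map f (upTo n)) + f n  ≡⟨ cong₂ _+_ (go m≤′n) (f≡0 n (≤′⇒≤ m≤′n)) ⟩
    sum (map f (upTo m)) + 0    ≡⟨ +-identityʳ _ ⟩
    sum (map f (upTo m)) ∎

infixl 7 _÷_
_÷_ : ℕ → ℕ → ℕ
n ÷ zero  = 0
n ÷ suc p = n / suc p

*-÷-assoc : ∀ m {n p} → p ∣ n → m * n ÷ p ≡ m * (n ÷ p)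
*-÷-assoc m {p = zero}  _   = sym (*-zeroʳ m)
*-÷-assoc m {p = suc _} p∣n = *-/-assoc m p∣n

0÷n≡0 : ∀ n → 0 ÷ n ≡ 0
0÷n≡0 zero    = refl
0÷n≡0 (suc _) = refl

∂-term : ℕ → ℕ → ℕ
∂-term n p with prime? p | p ∣? n
... | yes _ | yes _ = n ÷ p
... | _     | _     = 0

∂≡sum-∂-term : ∀ n → ∂ n ≡ sum (map (∂-term n) (upTo (suc n)))
∂≡sum-∂-term n = trans (cong sum (map-cong (λ { zero → refl ; (suc _) → refl }) (primeDivisors n)))
                       (sum-map-filter (λ p → prime? p ×-dec p ∣? n) agree vanish (upTo (suc n)))
  where
  agree : ∀ {p} → Prime p × p ∣ n → ∂-term n p ≡ n ÷ p
  agree {p} (p-prime , p∣n) with prime? p | p ∣? n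
  ... | yes _ | yes _   = refl
  ... | no ¬p | _       = contradiction p-prime ¬p
  ... | yes _ | no p∤n  = contradiction p∣n p∤n
  vanish : ∀ {p} → ¬ (Prime p × p ∣ n) → ∂-term n p ≡ 0
  vanish {p} ¬P with prime? p | p ∣? n
  ... | yes p-prime | yes p∣n = contradiction (p-prime , p∣n) ¬P
  ... | yes _       | no _    = refl
  ... | no _        | _       = refl

∂-term-vanishes : ∀ {n p} → n < p → ∂-term n p ≡ 0
∂-term-vanishes {n} {p} n<p with prime? p | p ∣? n
... | yes _ | no _  = refl
... | no _  | _     = refl
... | yes _ | yes p∣n with n
...   | zero  = 0÷n≡0 p
...   | suc _ = contradiction (∣⇒≤ p∣n) (<⇒≱ n<p)

∂≡sum-∂-term-upTo : ∀ {n N} → n < N → ∂ n ≡ sum (map (∂-term n) (upTo N))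
∂≡sum-∂-term-upTo {n} n<N =
  trans (∂≡sum-∂-term n) (sym (sum-map-upTo-vanishing (λ _ → ∂-term-vanishes) n<N))

∂-term-*-coprime : ∀ {m n} → Coprime m n → ∀ p → ∂-term (m * n) p ≡ ∂-term m p * n + m * ∂-term n p
∂-term-*-coprime {m} {n} m⊥n p with prime? p | p ∣? m | p ∣? n | p ∣? m * n
... | no _        | _       | _       | _        = sym (*-zeroʳ m)
... | yes p-prime | yes p∣m | yes p∣n | _        = ⊥-elim (¬prime[1] (subst Prime (m⊥n (p∣m , p∣n)) p-prime))
... | yes _       | yes p∣m | no _    | no p∤mn  = contradiction (∣m⇒∣m*n n p∣m) p∤mn
... | yes _       | yes p∣m | no _    | yes _    = begin
  m * n ÷ p         ≡⟨ cong (_÷ p) (*-comm m n) ⟩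
  n * m ÷ p         ≡⟨ *-÷-assoc n p∣m ⟩
  n * (m ÷ p)       ≡⟨ *-comm n (m ÷ p) ⟩
  m ÷ p * n         ≡⟨ +-identityʳ _ ⟨
  m ÷ p * n + 0     ≡⟨ cong (m ÷ p * n +_) (*-zeroʳ m) ⟨
  m ÷ p * n + m * 0 ∎
... | yes _       | no _    | yes p∣n | no p∤mn  = contradiction (∣n⇒∣m*n m p∣n) p∤mn
... | yes _       | no _    | yes p∣n | yes _    = *-÷-assoc m p∣n
... | yes _       | no _    | no _    | no _     = sym (*-zeroʳ m)
... | yes p-prime | no p∤m  | no p∤n  | yes p∣mn with euclidsLemma m n p-prime p∣mn
...   | inj₁ p∣m = contradiction p∣m p∤m
...   | inj₂ p∣n = contradiction p∣n p∤n

∂-*-coprime : ∀ {m n} → Coprime m n → ∂ (m * n) ≡ ∂ m * n + m * ∂ n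
∂-*-coprime {m} {n} m⊥n = begin
  ∂ (m * n)
    ≡⟨ ∂≡sum-∂-term-upTo mn<N ⟩
  sum (map (∂-term (m * n)) (upTo N))
    ≡⟨ sum-map-linear {f = ∂-term m} {∂-term n} n m (∂-term-*-coprime m⊥n) (upTo N) ⟩
  sum (map (∂-term m) (upTo N)) * n + m * sum (map (∂-term n) (upTo N))
    ≡⟨ cong₂ (λ a b → a * n + m * b) (∂≡sum-∂-term-upTo m<N) (∂≡sum-∂-term-upTo n<N) ⟨
  ∂ m * n + m * ∂ n ∎
  where
  N : ℕ
  N = suc (m * n + m + n)
  m<N : m < N
  m<N = s≤s (≤-trans (m≤n+m m (m * n)) (m≤m+n (m * n + m) n))
  n<N : n < N
  n<N = s≤s (m≤n+m n (m * n + m))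
  mn<N : m * n < N
  mn<N = s≤s (≤-trans (m≤m+n (m * n) m) (m≤m+n (m * n + m) n))

coprime-∣ˡ : ∀ {d m n} → d ∣ m → Coprime m n → Coprime d n
coprime-∣ˡ d∣m m⊥n (e∣d , e∣n) = m⊥n (∣-trans e∣d d∣m , e∣n)

coprime-*ˡ : ∀ {m n o} → Coprime m o → Coprime n o → Coprime (m * n) o
coprime-*ˡ m⊥o n⊥o (d∣mn , d∣o) =
  n⊥o (coprime-divisor (coprime-∣ˡ d∣o (coprime-sym m⊥o)) d∣mn , d∣o)

squareFree-*-coprime : ∀ {m n} → Coprime m n → SquareFree m → SquareFree n → SquareFree (m * n)
squareFree-*-coprime {m} {n} m⊥n m-sqf n-sqf p p-prime p²∣mn
  with euclidsLemma m n p-prime (∣-trans (m∣m*n p) p²∣mn)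
... | inj₁ p∣m = m-sqf p p-prime
      (coprime-divisor (coprime-*ˡ p⊥n p⊥n) (subst (p * p ∣_) (*-comm m n) p²∣mn))
  where
  p⊥n : Coprime p n
  p⊥n = coprime-∣ˡ p∣m m⊥n
... | inj₂ p∣n = n-sqf p p-prime (coprime-divisor (coprime-*ˡ p⊥m p⊥m) p²∣mn)
  where
  p⊥m : Coprime p m
  p⊥m = coprime-∣ˡ p∣n (coprime-sym m⊥n)

*-pseudoperfect-equation : ∀ {d k c e} → d + 1 ≡ k →
  d * c + k * e + 1 ≡ k * c ⇔ c ≡ k * e + 1
*-pseudoperfect-equation {d} {k} {c} {e} d+1≡k = mk⇔
  (λ eq → sym (+-cancelˡ-≡ (d * c) _ _ (trans (sym (+-assoc (d * c) (k * e) 1)) (trans eq kc≡dc+c))))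
  (λ eq → trans (+-assoc (d * c) (k * e) 1) (trans (cong (d * c +_) (sym eq)) (sym kc≡dc+c)))
  where
  kc≡dc+c : k * c ≡ d * c + c
  kc≡dc+c = begin
    k * c           ≡⟨ cong (_* c) d+1≡k ⟨
    (d + 1) * c     ≡⟨ *-distribʳ-+ c d 1 ⟩
    d * c + 1 * c   ≡⟨ cong (d * c +_) (*-identityˡ c) ⟩
    d * c + c ∎

mainTheorem2 : (K C : ℕ) → PrimaryPseudoperfect K → SquareFree C → 1 ≤ C → Coprime C K →
    (PrimaryPseudoperfect (K * C) ⇔ (C ≡ K * ∂ C + 1))
mainTheorem2 K C (K-sqf , 1≤K , ∂K+1≡K) C-sqf 1≤C C⊥K = mk⇔
  (λ (_ , _ , ∂KC+1≡KC) → Equivalence.to equation ∂KC+1≡KC)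
  (λ C≡K∂C+1 → squareFree-*-coprime K⊥C K-sqf C-sqf , *-mono-≤ 1≤K 1≤C , Equivalence.from equation C≡K∂C+1)
  where
  K⊥C : Coprime K C
  K⊥C = coprime-sym C⊥K
  equation : ∂ (K * C) + 1 ≡ K * C ⇔ C ≡ K * ∂ C + 1
  equation = subst (λ x → x + 1 ≡ K * C ⇔ C ≡ K * ∂ C + 1) (sym (∂-*-coprime K⊥C))
                   (*-pseudoperfect-equation ∂K+1≡K)
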